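{- Let $X$ be a non-empty set of positive integers with $X\neq\{1\}$. Both graphs $\Gamma(X)$ and $\Delta(X)$ are acyclic if and only if each connected component of $B(X)$ is a path or a cycle of length $4$.
   Context: For a non-empty set $X$ of positive integers, $\rho(X)$ is the set of primes dividing some element of $X$ and $X^*=X\setminus\{1\}$. $B(X)$ is the bipartite graph with vertex set the disjoint union $\rho(X)\cup X^*$ and edges $\{p,x\}$ for $p\in\rho(X)$, $x\in X^*$, $p\mid x$. $\Delta(X)$ has vertex set $\rho(X)$, distinct $p,q$ adjacent iff $pq$ divides some element of $X$. $\Gamma(X)$ has vertex set $X^*$, distinct $x,y$ adjacent iff $\gcd(x,y)>1$. A graph is acyclic if it contains no closed path of length at least $3$ (no cycle). -}

module Defs where

open import Level using (0ℓ)
open import Data.Nat using (ℕ; _≤_; _<_; _*_)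
open import Data.Nat.Divisibility using (_∣_)
open import Data.Nat.GCD using (gcd)
open import Data.Nat.Primality using (Prime)
open import Data.List using (List; []; _∷_; _++_; _∷ʳ_; length)
open import Data.List.Membership.Propositional using (_∈_)
open import Data.List.Relation.Unary.All using (All)
open import Data.List.Relation.Unary.Unique.Propositional using (Unique)
open import Data.List.Relation.Unary.Linked using (Linked)
open import Data.Product using (Σ; ∃; ∃-syntax; _×_)
open import Data.Sum using (_⊎_; inj₁; inj₂)
open import Relation.Nullary using (¬_)
open import Data.Empty using (⊥)
open import Relation.Binary.PropositionalEquality using (_≡_; _≢_)
open import Function.Bundles using (_⇔_)

-- A (simple) graph: an ambient type of names, a vertex predicate and an
-- adjacency relation (only meaningful between vertices).
record Graph : Set₁ where
  field
    V    : Set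
    Vert : V → Set
    Adj  : V → V → Set
open Graph public

-- A cycle: distinct vertices v ∷ vs (at least 3 of them), consecutive
-- ones adjacent, and the last adjacent to the first (closed path).
HasCycle : Graph → Set
HasCycle G = Σ (V G) λ v → Σ (List (V G)) λ vs →
  (2 ≤ length vs) × Unique (v ∷ vs) × All (Vert G) (v ∷ vs)
  × Linked (Adj G) ((v ∷ vs) ∷ʳ v)

Acyclic : Graph → Set
Acyclic G = ¬ HasCycle G

data Reach (G : Graph) : V G → V G → Set where
  here : ∀ {u} → Vert G u → Reach G u u
  step : ∀ {u v w} → Vert G u → Adj G u v → Reach G v w → Reach G u w

Consecutive : {A : Set} → List A → A → A → Set
Consecutive L a b = ∃[ xs ] ∃[ ys ] (L ≡ xs ++ a ∷ b ∷ ys ⊎ L ≡ xs ++ b ∷ a ∷ ys)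

EnumeratesComponent : (G : Graph) → V G → List (V G) → Set
EnumeratesComponent G v L = Unique L × (∀ w → (w ∈ L ⇔ Reach G v w))

ComponentIsPath : (G : Graph) → V G → Set
ComponentIsPath G v = ∃[ L ] (EnumeratesComponent G v L ×
  (∀ a b → a ∈ L → b ∈ L → (Adj G a b ⇔ Consecutive L a b)))

ComponentIsC4 : (G : Graph) → V G → Set
ComponentIsC4 G v = ∃[ a ] ∃[ b ] ∃[ c ] ∃[ d ]
  (EnumeratesComponent G v (a ∷ b ∷ c ∷ d ∷ []) ×
   (∀ x y → x ∈ (a ∷ b ∷ c ∷ d ∷ []) → y ∈ (a ∷ b ∷ c ∷ d ∷ []) →
     (Adj G x y ⇔ Consecutive (a ∷ b ∷ c ∷ d ∷ a ∷ []) x y)))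

-- The graphs attached to a finite set X of positive integers (a list;
-- only membership matters).

InRho : List ℕ → ℕ → Set
InRho X p = Prime p × ∃[ x ] (x ∈ X × p ∣ x)

InXStar : List ℕ → ℕ → Set
InXStar X x = x ∈ X × x ≢ 1

Delta : List ℕ → Graph
Delta X = record
  { V = ℕ
  ; Vert = InRho X
  ; Adj = λ p q → InRho X p × InRho X q × p ≢ q × ∃[ x ] (x ∈ X × p * q ∣ x)
  }

Gamma : List ℕ → Graph
Gamma X = record
  { V = ℕ
  ; Vert = InXStar X
  ; Adj = λ x y → InXStar X x × InXStar X y × x ≢ y × 1 < gcd x y
  }

-- B(X): vertex set ρ(X) ⊎ X*, primes on the left, elements on the right.
BVert : List ℕ → ℕ ⊎ ℕ → Set
BVert X (inj₁ p) = InRho X p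
BVert X (inj₂ x) = InXStar X x

BAdj : List ℕ → ℕ ⊎ ℕ → ℕ ⊎ ℕ → Set
BAdj X (inj₁ p) (inj₂ x) = InRho X p × InXStar X x × p ∣ x
BAdj X (inj₂ x) (inj₁ p) = InRho X p × InXStar X x × p ∣ x
BAdj X (inj₁ _) (inj₁ _) = ⊥
BAdj X (inj₂ _) (inj₂ _) = ⊥

Bip : List ℕ → Graph
Bip X = record { V = ℕ ⊎ ℕ ; Vert = BVert X ; Adj = BAdj X }

module Submission where

-- If Γ(X) and Δ(X) are acyclic, no prime divides three elements of X and no element has three
-- prime divisors, so B(X) has maximum degree two and each component is a path or a cycle. Being
-- bipartite, B(X) has no 3-cycle, and a cycle of length at least 6 runs through at least three
-- elements, consecutive ones sharing a prime: a cycle of Γ(X). Conversely, a cycle of Γ(X) or of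
-- Δ(X) gives distinct vertices on one side of B(X), each at distance two from the next, all in one
-- component. Along a path their positions change by ±2 at every step without repeating, so they
-- cannot return to the start; and a 4-cycle has only two vertices on each side.

open import Defs
open import Level using (0ℓ)
open import Data.Nat using (ℕ; zero; suc; _<_; _≤_; _+_; _*_; z≤n; s≤s; _≟_)
open import Data.Nat.Base using (≢-nonZero; >-nonZero; nonTrivial⇒n>1)
open import Data.Nat.Properties using (suc-injective; <⇒≱; +-suc; +-comm; +-identityʳ; ≤-refl; <-≤-trans; <-irrefl; <-trans; m≤n+m)
open import Data.Nat.Divisibility using (_∣_; _∣?_; ∣⇒≤; ∣-trans; ∣1⇒≡1; m∣m*n; *-monoˡ-∣; m∣n⇒n≡quotient*m; quotient; m*n∣⇒m∣; m*n∣⇒n∣)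
open import Data.Nat.GCD using (gcd; gcd-greatest; gcd[m,n]≢0; gcd[m,n]∣m; gcd[m,n]∣n)
open import Data.Nat.Primality using (Prime; prime?; prime⇒nonTrivial; prime⇒irreducible; euclidsLemma)
open import Data.Nat.Primality.Factorisation using (factorise)
open import Data.Nat.ListAction using (product)
open import Data.List using (List; []; _∷_; _++_; _∷ʳ_; length; reverse; map; upTo; concatMap)
open import Data.List.Properties using (∷ʳ-++; length-++; length-++-sucʳ; map-++; reverse-++; unfold-reverse; ++-assoc; ∷ʳ-injectiveʳ)
open import Data.List.Membership.Propositional using (_∈_; _∉_; find; lose)
open import Data.List.Membership.Propositional.Properties using (∈-++⁺ˡ; ∈-++⁺ʳ; ∈-++⁻; ∈-∃++; ∈-map⁺; ∈-upTo⁺; ∈-concatMap⁺)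
open import Data.List.Relation.Binary.Subset.Propositional using (_⊆_)
open import Data.List.Relation.Unary.Any using (here; there; any?)
import Data.List.Relation.Unary.Any.Properties as Any
open import Data.List.Relation.Unary.All using (All; []; _∷_)
import Data.List.Relation.Unary.All as All
open import Data.List.Relation.Unary.All.Properties using (¬Any⇒All¬; ∷ʳ⁻)
open import Data.List.Relation.Unary.AllPairs using ([]; _∷_)
open import Data.List.Relation.Unary.Unique.Propositional using (Unique)
import Data.List.Relation.Unary.Unique.Propositional.Properties as Unique
open import Data.List.Relation.Unary.Linked using (Linked; []; [-]; _∷_)
import Data.List.Relation.Unary.Linked as Linked
import Data.List.Relation.Unary.Linked.Properties as Linked
open import Data.List.Relation.Binary.Permutation.Setoid using (↭-sym)
open import Data.List.Relation.Binary.Permutation.Setoid.Properties using (Unique-resp-↭; ↭-reverse; ∷↭∷ʳ)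
open import Data.Product using (∃; ∃₂; _×_; _,_; proj₁)
open import Data.Sum using (_⊎_; inj₁; inj₂)
import Data.Sum as Sum
open import Data.Sum.Properties using (≡-dec; inj₁-injective; inj₂-injective)
open import Data.Empty using (⊥; ⊥-elim)
open import Data.Unit using (⊤; tt)
open import Function using (_∘_)
open import Function.Bundles using (_⇔_; mk⇔; Equivalence)
open import Relation.Nullary using (¬_; Dec; yes; no; ¬?; _×-dec_)
open import Relation.Binary.Core using (Rel)
open import Relation.Binary.Definitions using (DecidableEquality; Symmetric; Decidable)
open import Relation.Binary.PropositionalEquality using (_≡_; _≢_; refl; sym; trans; cong; subst; module ≡-Reasoning)
open import Relation.Binary.PropositionalEquality.Properties using (setoid)

module _ {A : Set} where

  unique-∷ : ∀ {x : A} {xs} → x ∉ xs → Unique xs → Unique (x ∷ xs)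
  unique-∷ x∉xs u = ¬Any⇒All¬ _ x∉xs ∷ u

  unique-reverse : ∀ {xs : List A} → Unique xs → Unique (reverse xs)
  unique-reverse {xs} = Unique-resp-↭ (setoid A) (↭-sym (setoid A) (↭-reverse (setoid A) xs))

  unique-middle-∉ : ∀ xs {a : A} {ys} → Unique (xs ++ a ∷ ys) → a ∉ xs
  unique-middle-∉ (x ∷ xs) (x≢ ∷ _) (here refl) = All.lookup x≢ (∈-++⁺ʳ xs (here refl)) refl
  unique-middle-∉ (x ∷ xs) (_ ∷ u) (there a∈xs) = unique-middle-∉ xs u a∈xs

  unique-length-≤ : ∀ {P W : List A} → Unique P → P ⊆ W → length P ≤ length W
  unique-length-≤ {[]} _ _ = z≤n
  unique-length-≤ {x ∷ P} {W} (x∉P ∷ u) P⊆W with ∈-∃++ (P⊆W (here refl))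
  ... | w₁ , w₂ , refl =
    subst (suc (length P) ≤_) (sym (length-++-sucʳ w₁ x w₂)) (s≤s (unique-length-≤ u P⊆w₁w₂))
    where
    P⊆w₁w₂ : P ⊆ w₁ ++ w₂
    P⊆w₁w₂ a∈P with ∈-++⁻ w₁ (P⊆W (there a∈P))
    ... | inj₁ a∈w₁ = ∈-++⁺ˡ a∈w₁
    ... | inj₂ (here refl) = ⊥-elim (All.lookup x∉P a∈P refl)
    ... | inj₂ (there a∈w₂) = ∈-++⁺ʳ w₁ a∈w₂

  consecutive-∷ : ∀ {L : List A} {a b} w → Consecutive L a b → Consecutive (w ∷ L) a b
  consecutive-∷ w (xs , ys , inj₁ eq) = w ∷ xs , ys , inj₁ (cong (w ∷_) eq)
  consecutive-∷ w (xs , ys , inj₂ eq) = w ∷ xs , ys , inj₂ (cong (w ∷_) eq)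

  reverse-middle : ∀ (xs : List A) a b ys → reverse (xs ++ a ∷ b ∷ ys) ≡ reverse ys ++ b ∷ a ∷ reverse xs
  reverse-middle xs a b ys = begin
    reverse (xs ++ a ∷ b ∷ ys)                 ≡⟨ reverse-++ xs (a ∷ b ∷ ys) ⟩
    reverse ((a ∷ b ∷ []) ++ ys) ++ reverse xs ≡⟨ cong (_++ reverse xs) (reverse-++ (a ∷ b ∷ []) ys) ⟩
    (reverse ys ++ b ∷ a ∷ []) ++ reverse xs   ≡⟨ ++-assoc (reverse ys) (b ∷ a ∷ []) (reverse xs) ⟩
    reverse ys ++ b ∷ a ∷ reverse xs           ∎
    where open ≡-Reasoning

  consecutive-reverse : ∀ {L : List A} {a b} → Consecutive L a b → Consecutive (reverse L) a b
  consecutive-reverse (xs , ys , inj₁ refl) = reverse ys , reverse xs , inj₂ (reverse-middle xs _ _ ys)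
  consecutive-reverse (xs , ys , inj₂ refl) = reverse ys , reverse xs , inj₁ (reverse-middle xs _ _ ys)

  closed-walk-steps-distinct : ∀ {x y : A} ys → Unique (x ∷ y ∷ ys) → Linked _≢_ ((x ∷ y ∷ ys) ∷ʳ x)
  closed-walk-steps-distinct {x} ys u@((x≢y ∷ _) ∷ u′) = x≢y ∷ steps _ (Unique.Unique[x∷xs]⇒x∉xs u) u′
    where
    steps : ∀ zs → x ∉ zs → Unique zs → Linked _≢_ (zs ∷ʳ x)
    steps [] _ _ = [-]
    steps (z ∷ []) x∉zs _ = (λ z≡x → x∉zs (here (sym z≡x))) ∷ [-]
    steps (z ∷ z′ ∷ zs) x∉zs ((z≢z′ ∷ _) ∷ u″) = z≢z′ ∷ steps (z′ ∷ zs) (x∉zs ∘ there) u″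

  length-∷ʳ : ∀ (xs : List A) x → length (xs ∷ʳ x) ≡ suc (length xs)
  length-∷ʳ xs x = trans (length-++ xs) (+-comm _ 1)

  unique-rotate : ∀ {x : A} {xs} → Unique (x ∷ xs) → Unique (xs ∷ʳ x)
  unique-rotate {x} {xs} = Unique-resp-↭ (setoid A) (∷↭∷ʳ (setoid A) x xs)

  unique-map-on : ∀ {B : Set} {P : A → Set} {f : A → B} → (∀ {a b} → P a → P b → f a ≡ f b → a ≡ b) →
    ∀ {xs} → All P xs → Unique xs → Unique (map f xs)
  unique-map-on f-inj [] [] = []
  unique-map-on {P = P} {f} f-inj {a ∷ _} (pa ∷ ps) (a∉ ∷ u) = images-differ ps a∉ ∷ unique-map-on f-inj ps u
    where
    images-differ : ∀ {ys} → All P ys → All (a ≢_) ys → All (f a ≢_) (map f ys)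
    images-differ [] [] = []
    images-differ (pb ∷ pbs) (a≢b ∷ a≢bs) = a≢b ∘ f-inj pa pb ∷ images-differ pbs a≢bs

  ∷ʳ-is-∷ : ∀ (xs : List A) y → ∃₂ λ z zs → xs ∷ʳ y ≡ z ∷ zs
  ∷ʳ-is-∷ [] y = y , [] , refl
  ∷ʳ-is-∷ (x ∷ xs) y = x , xs ∷ʳ y , refl

module _ {A : Set} {R : Rel A 0ℓ} where

  linked-middle : ∀ xs {a b ys} → Linked R (xs ++ a ∷ b ∷ ys) → R a b
  linked-middle [] (r ∷ _) = r
  linked-middle (x ∷ []) (_ ∷ l) = linked-middle [] l
  linked-middle (x ∷ y ∷ xs) (_ ∷ l) = linked-middle (y ∷ xs) l

  linked-consecutive : Symmetric R → ∀ {L a b} → Linked R L → Consecutive L a b → R a b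
  linked-consecutive R-sym l (xs , ys , inj₁ refl) = linked-middle xs l
  linked-consecutive R-sym l (xs , ys , inj₂ refl) = R-sym (linked-middle xs l)

  linked-∷ʳ : ∀ ys {a z} → Linked R (ys ∷ʳ a) → R a z → Linked R (ys ∷ʳ a ∷ʳ z)
  linked-∷ʳ [] _ r = r ∷ [-]
  linked-∷ʳ (y ∷ []) (r′ ∷ _) r = r′ ∷ r ∷ [-]
  linked-∷ʳ (y ∷ y′ ∷ ys) (r′ ∷ l) r = r′ ∷ linked-∷ʳ (y′ ∷ ys) l r

  linked-reverse : Symmetric R → ∀ {L} → Linked R L → Linked R (reverse L)
  linked-reverse R-sym {[]} l = []
  linked-reverse R-sym {x ∷ []} l = [-]
  linked-reverse R-sym {x ∷ y ∷ ys} (r ∷ l)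
    rewrite unfold-reverse x (y ∷ ys) | unfold-reverse y ys =
      linked-∷ʳ (reverse ys) (subst (Linked R) (unfold-reverse y ys) (linked-reverse R-sym l)) (R-sym r)

  linked-last-predecessor : ∀ y ys {a} → Linked R ((y ∷ ys) ∷ʳ a) → ∃ λ b → b ∈ y ∷ ys × R b a
  linked-last-predecessor y [] (r ∷ _) = y , here refl , r
  linked-last-predecessor y (y′ ∷ ys) (_ ∷ l) with linked-last-predecessor y′ ys l
  ... | b , b∈ , r = b , there b∈ , r

  linked-sources : ∀ {P : A → Set} → (∀ {a b} → R a b → P a) → ∀ xs {y} → Linked R (xs ∷ʳ y) → All P xs
  linked-sources R⇒P [] _ = []
  linked-sources R⇒P (x ∷ []) (r ∷ _) = R⇒P r ∷ []
  linked-sources R⇒P (x ∷ x′ ∷ xs) (r ∷ l) = R⇒P r ∷ linked-sources R⇒P (x′ ∷ xs) l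

  linked-map-on : ∀ {P : A → Set} {S : Rel A 0ℓ} → (∀ {a b} → P a → P b → R a b → S a b) →
    ∀ {xs} → All P xs → Linked R xs → Linked S xs
  linked-map-on R⇒S [] [] = []
  linked-map-on R⇒S (_ ∷ []) [-] = [-]
  linked-map-on R⇒S (pa ∷ pb ∷ ps) (r ∷ l) = R⇒S pa pb r ∷ linked-map-on R⇒S (pb ∷ ps) l

  closed-walk-rotate : ∀ {x y} ys → Linked R ((x ∷ y ∷ ys) ∷ʳ x) → Linked R ((y ∷ ys) ∷ʳ x ∷ʳ y)
  closed-walk-rotate ys (r ∷ l) = linked-∷ʳ (_ ∷ ys) l r

record IsFiniteSimpleGraph (G : Graph) : Set where
  field
    _≟ᵥ_              : DecidableEquality (V G)
    adj?              : Decidable (Adj G)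
    adj-sym           : Symmetric (Adj G)
    adj-irrefl        : ∀ {a} → ¬ Adj G a a
    adj-vert          : ∀ {a b} → Adj G a b → Vert G b
    vertices          : List (V G)
    vertices-complete : ∀ {a} → Vert G a → a ∈ vertices

ComponentHasHamiltonianCycle : (G : Graph) → V G → Set
ComponentHasHamiltonianCycle G v = ∃₂ λ w vs →
  2 ≤ length vs × EnumeratesComponent G v (w ∷ vs) × Linked (Adj G) ((w ∷ vs) ∷ʳ w)

module Walks {G : Graph} (S : IsFiniteSimpleGraph G) where

  open IsFiniteSimpleGraph S

  reach-vert : ∀ {u w} → Reach G u w → Vert G w
  reach-vert (here w) = w
  reach-vert (step _ _ r) = reach-vert r

  reach-trans : ∀ {u w x} → Reach G u w → Reach G w x → Reach G u x
  reach-trans (here _) r = r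
  reach-trans (step u uw r) r′ = step u uw (reach-trans r r′)

  reach-∷ʳ : ∀ {u w x} → Reach G u w → Adj G w x → Reach G u x
  reach-∷ʳ r wx = reach-trans r (step (adj-vert (adj-sym wx)) wx (here (adj-vert wx)))

  Closed : List (V G) → Set
  Closed C = ∀ {a b} → a ∈ C → Adj G a b → b ∈ C

  closed-reach : ∀ {C u w} → Closed C → u ∈ C → Reach G u w → w ∈ C
  closed-reach C-closed u∈C (here _) = u∈C
  closed-reach C-closed u∈C (step _ uw r) = closed-reach C-closed (C-closed u∈C uw) r

  closed⇒enumerates-component : ∀ {v C} → Unique C → (∀ {a} → a ∈ C → Reach G v a) → v ∈ C →
    Closed C → EnumeratesComponent G v C
  closed⇒enumerates-component C-unique C-reachable v∈C C-closed =
    C-unique , λ w → mk⇔ C-reachable (closed-reach C-closed v∈C)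

module MaxDegreeTwo {G : Graph} (S : IsFiniteSimpleGraph G)
  (degree≤2 : ∀ {a b c d} → Adj G a b → Adj G a c → Adj G a d → b ≢ c → b ≢ d → c ≢ d → ⊥) where

  open IsFiniteSimpleGraph S
  open Walks S
  open import Data.List.Membership.DecPropositional _≟ᵥ_ using (_∈?_)

  private
    A = V G
    _~_ = Adj G

  third-neighbour : ∀ {a b c d} → a ~ b → a ~ c → a ~ d → b ≢ c → d ≡ b ⊎ d ≡ c
  third-neighbour {b = b} {c} {d} ab ac ad b≢c with d ≟ᵥ b | d ≟ᵥ c
  ... | yes d≡b | _       = inj₁ d≡b
  ... | no _    | yes d≡c = inj₂ d≡c
  ... | no d≢b  | no d≢c  = ⊥-elim (degree≤2 ab ac ad b≢c (d≢b ∘ sym) (d≢c ∘ sym))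

  TwoNeighboursIn : A → List A → Set
  TwoNeighboursIn a L = ∃₂ λ b c → b ∈ L × c ∈ L × b ≢ c × a ~ b × a ~ c

  two-neighbours-closed : ∀ {a d L} → TwoNeighboursIn a L → a ~ d → d ∈ L
  two-neighbours-closed (b , c , b∈L , c∈L , b≢c , ab , ac) ad with third-neighbour ab ac ad b≢c
  ... | inj₁ refl = b∈L
  ... | inj₂ refl = c∈L

  two-neighbours-∷ : ∀ {a L} w → TwoNeighboursIn a L → TwoNeighboursIn a (w ∷ L)
  two-neighbours-∷ w (b , c , b∈L , c∈L , rest) = b , c , there b∈L , there c∈L , rest

  end-or-interior : ∀ {a L} → Unique L → Linked _~_ L → a ∈ L →
    (∃ λ ys → L ≡ a ∷ ys) ⊎ (∃ λ xs → L ≡ xs ∷ʳ a) ⊎ TwoNeighboursIn a L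
  end-or-interior {L = x ∷ xs} _ _ (here refl) = inj₁ (xs , refl)
  end-or-interior {L = x ∷ y ∷ rest} (x∉ ∷ u) (xy ∷ l) (there a∈) with end-or-interior u l a∈
  end-or-interior {L = x ∷ y ∷ []} _ _ _ | inj₁ (_ , refl) = inj₂ (inj₁ (x ∷ [] , refl))
  end-or-interior {L = x ∷ y ∷ z ∷ rest} (x∉ ∷ _) (xy ∷ yz ∷ _) _ | inj₁ (_ , refl) =
    inj₂ (inj₂ (x , z , here refl , there (there (here refl)) , All.lookup x∉ (there (here refl)) , adj-sym xy , yz))
  ... | inj₂ (inj₁ (xs , eq)) = inj₂ (inj₁ (x ∷ xs , cong (x ∷_) eq))
  ... | inj₂ (inj₂ interior) = inj₂ (inj₂ (two-neighbours-∷ x interior))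

  record InducedPath (v : A) (P : List A) : Set where
    field
      unique    : Unique P
      linked    : Linked _~_ P
      induced   : ∀ {a b} → a ∈ P → b ∈ P → a ~ b → Consecutive P a b
      reachable : ∀ {a} → a ∈ P → Reach G v a
      start     : v ∈ P
  open InducedPath

  singleton-path : ∀ {v} → Vert G v → InducedPath v (v ∷ [])
  singleton-path v-vert = record
    { unique = [] ∷ []
    ; linked = [-]
    ; induced = λ { (here refl) (here refl) vv → ⊥-elim (adj-irrefl vv) }
    ; reachable = λ { (here refl) → here v-vert }
    ; start = here refl
    }

  extend : ∀ {v w e rest} → InducedPath v (e ∷ rest) → e ~ w → w ∉ e ∷ rest →
    (∀ {q} → q ∈ rest → ¬ w ~ q) → InducedPath v (w ∷ e ∷ rest)
  extend {v} {w} {e} {rest} I ew w∉P no-chord = record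
    { unique = unique-∷ w∉P (unique I)
    ; linked = adj-sym ew ∷ linked I
    ; induced = induced′
    ; reachable = reachable′
    ; start = there (start I)
    }
    where
    induced′ : ∀ {a b} → a ∈ w ∷ e ∷ rest → b ∈ w ∷ e ∷ rest → a ~ b → Consecutive (w ∷ e ∷ rest) a b
    induced′ (here refl) (here refl) ab = ⊥-elim (adj-irrefl ab)
    induced′ (here refl) (there (here refl)) _ = [] , rest , inj₁ refl
    induced′ (here refl) (there (there b∈)) ab = ⊥-elim (no-chord b∈ ab)
    induced′ (there (here refl)) (here refl) _ = [] , rest , inj₂ refl
    induced′ (there (there a∈)) (here refl) ab = ⊥-elim (no-chord a∈ (adj-sym ab))
    induced′ (there a∈) (there b∈) ab = consecutive-∷ w (induced I a∈ b∈ ab)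
    reachable′ : ∀ {a} → a ∈ w ∷ e ∷ rest → Reach G v a
    reachable′ (here refl) = reach-∷ʳ (reachable I (here refl)) ew
    reachable′ (there a∈) = reachable I a∈

  reverse-induced : ∀ {v P} → InducedPath v P → InducedPath v (reverse P)
  reverse-induced I = record
    { unique = unique-reverse (unique I)
    ; linked = linked-reverse adj-sym (linked I)
    ; induced = λ a∈ b∈ ab → consecutive-reverse (induced I (Any.reverse⁻ a∈) (Any.reverse⁻ b∈) ab)
    ; reachable = reachable I ∘ Any.reverse⁻
    ; start = Any.reverse⁺ (start I)
    }

  close-cycle : ∀ {v w e rest q} → InducedPath v (e ∷ rest) → e ~ w → w ∉ e ∷ rest →
    q ∈ rest → w ~ q → ComponentHasHamiltonianCycle G v
  close-cycle {v} {w} {e} {r ∷ rs} {q} I ew w∉P q∈rest wq =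
    w , P , s≤s (s≤s z≤n) ,
    closed⇒enumerates-component (unique-∷ w∉P (unique I)) reachable′ (there (start I)) closed , cycle
    where
    P = e ∷ r ∷ rs
    e∉rest : e ∉ r ∷ rs
    e∉rest = Unique.Unique[x∷xs]⇒x∉xs (unique I)
    q-last : ∃ λ xs → P ≡ xs ∷ʳ q
    q-last with end-or-interior (unique I) (linked I) (there q∈rest)
    ... | inj₁ (_ , refl) = ⊥-elim (e∉rest q∈rest)
    ... | inj₂ (inj₁ q-last) = q-last
    ... | inj₂ (inj₂ interior) = ⊥-elim (w∉P (two-neighbours-closed interior (adj-sym wq)))
    cycle : Linked _~_ ((w ∷ P) ∷ʳ w)
    cycle with q-last
    ... | xs , P≡xs∷ʳq = adj-sym ew ∷ subst (λ L → Linked _~_ (L ∷ʳ w)) (sym P≡xs∷ʳq)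
                           (linked-∷ʳ xs (subst (Linked _~_) P≡xs∷ʳq (linked I)) (adj-sym wq))
    last-neighbours : ∀ {a} ys → P ≡ ys ∷ʳ a → TwoNeighboursIn a (w ∷ P)
    last-neighbours [] ()
    last-neighbours (y ∷ ys) P≡ys∷ʳa with q-last
    ... | xs , P≡xs∷ʳq with ∷ʳ-injectiveʳ (y ∷ ys) xs (trans (sym P≡ys∷ʳa) P≡xs∷ʳq)
    ... | refl with linked-last-predecessor y ys (subst (Linked _~_) P≡ys∷ʳa (linked I))
    ... | p , p∈ys , pq = w , p , here refl , there p∈P , (λ w≡p → w∉P (subst (_∈ P) (sym w≡p) p∈P)) ,
                          adj-sym wq , adj-sym pq
      where
      p∈P : p ∈ P
      p∈P = subst (p ∈_) (sym P≡ys∷ʳa) (∈-++⁺ˡ p∈ys)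
    two-neighbours : ∀ {a} → a ∈ w ∷ P → TwoNeighboursIn a (w ∷ P)
    two-neighbours (here refl) =
      e , q , there (here refl) , there (there q∈rest) ,
      (λ e≡q → e∉rest (subst (_∈ r ∷ rs) (sym e≡q) q∈rest)) , adj-sym ew , wq
    two-neighbours (there a∈P) with end-or-interior (unique I) (linked I) a∈P
    ... | inj₁ (_ , refl) = w , r , here refl , there (there (here refl)) ,
                            (λ w≡r → w∉P (there (here w≡r))) , ew , Linked.head (linked I)
    ... | inj₂ (inj₁ (ys , P≡ys∷ʳa)) = last-neighbours ys P≡ys∷ʳa
    ... | inj₂ (inj₂ interior) = two-neighbours-∷ w interior
    closed : Closed (w ∷ P)
    closed a∈ ab = two-neighbours-closed (two-neighbours a∈) ab
    reachable′ : ∀ {a} → a ∈ w ∷ P → Reach G v a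
    reachable′ (here refl) = reach-∷ʳ (reachable I (here refl)) ew
    reachable′ (there a∈) = reachable I a∈

  Stuck : A → List A → Set
  Stuck e P = ∀ {b} → e ~ b → b ∈ P

  GrowthResult : A → (List A → Set) → Set
  GrowthResult v Q = (∃₂ λ e rest → InducedPath v (e ∷ rest) × Q (e ∷ rest) × Stuck e (e ∷ rest))
                   ⊎ ComponentHasHamiltonianCycle G v

  -- Q is an invariant of the path kept while extending at its head (the second pass uses it to
  -- remember that the other end is stuck); the fuel cannot run out, since by pigeonhole a path
  -- never has more vertices than the graph.
  grow : ∀ {v} (Q : List A → Set) → (∀ {w L} → Q L → Q (w ∷ L)) → ∀ fuel e rest →
    length vertices < length (e ∷ rest) + fuel → InducedPath v (e ∷ rest) → Q (e ∷ rest) → GrowthResult v Q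
  grow Q Q-∷ zero e rest too-long I _ =
    ⊥-elim (<⇒≱ (subst (length vertices <_) (+-identityʳ _) too-long)
                (unique-length-≤ (unique I) (vertices-complete ∘ reach-vert ∘ reachable I)))
  grow Q Q-∷ (suc fuel) e rest too-long I q with any? (λ w → adj? e w ×-dec ¬? (w ∈? (e ∷ rest))) vertices
  ... | no no-exit = inj₁ (e , rest , I , q , stuck)
    where
    stuck : Stuck e (e ∷ rest)
    stuck {b} eb with b ∈? (e ∷ rest)
    ... | yes b∈P = b∈P
    ... | no b∉P = ⊥-elim (no-exit (lose (vertices-complete (adj-vert eb)) (eb , b∉P)))
  ... | yes exit with find exit
  ... | w , _ , ew , w∉P with any? (adj? w) rest
  ... | yes chord with find chord
  ...   | _ , q∈rest , wq = inj₂ (close-cycle I ew w∉P q∈rest wq)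
  grow Q Q-∷ (suc fuel) e rest too-long I q | yes _ | w , _ , ew , w∉P | no no-chord =
    grow Q Q-∷ fuel w (e ∷ rest) (subst (length vertices <_) (+-suc _ fuel) too-long)
      (extend I ew w∉P (λ q∈rest wq → no-chord (lose q∈rest wq))) (Q-∷ q)

  EndsStuckAt : A → List A → Set
  EndsStuckAt z L = (∃ λ xs → L ≡ xs ∷ʳ z) × Stuck z L

  ends-stuck-∷ : ∀ {z w L} → EndsStuckAt z L → EndsStuckAt z (w ∷ L)
  ends-stuck-∷ {w = w} ((xs , L≡xs∷ʳz) , stuck) = (w ∷ xs , cong (w ∷_) L≡xs∷ʳz) , there ∘ stuck

  turn-around : ∀ {v h ps} → InducedPath v (h ∷ ps) → Stuck h (h ∷ ps) →
    ∃₂ λ e rest → InducedPath v (e ∷ rest) × EndsStuckAt h (e ∷ rest)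
  turn-around {v} {h} {ps} I stuck with ∷ʳ-is-∷ (reverse ps) h
  ... | e , rest , eq =
    e , rest , subst (InducedPath v) reversed (reverse-induced I) ,
    (reverse ps , trans (sym reversed) (unfold-reverse h ps)) ,
    subst (_ ∈_) reversed ∘ Any.reverse⁺ ∘ stuck
    where
    reversed : reverse (h ∷ ps) ≡ e ∷ rest
    reversed = trans (unfold-reverse h ps) eq

  both-ends-stuck⇒path : ∀ {v e rest z} → InducedPath v (e ∷ rest) → EndsStuckAt z (e ∷ rest) →
    Stuck e (e ∷ rest) → ComponentIsPath G v
  both-ends-stuck⇒path {v} {e} {rest} I ((xs , P≡xs∷ʳz) , z-stuck) e-stuck =
    e ∷ rest , closed⇒enumerates-component (unique I) (reachable I) (start I) closed ,
    λ _ _ a∈ b∈ → mk⇔ (induced I a∈ b∈) (linked-consecutive adj-sym (linked I))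
    where
    closed : Closed (e ∷ rest)
    closed a∈ ab with end-or-interior (unique I) (linked I) a∈
    ... | inj₁ (_ , refl) = e-stuck ab
    ... | inj₂ (inj₂ interior) = two-neighbours-closed interior ab
    ... | inj₂ (inj₁ (ys , P≡ys∷ʳa)) with ∷ʳ-injectiveʳ ys xs (trans (sym P≡ys∷ʳa) P≡xs∷ʳz)
    ...   | refl = z-stuck ab

  component-path-or-cycle : ∀ v → Vert G v → ComponentIsPath G v ⊎ ComponentHasHamiltonianCycle G v
  component-path-or-cycle v v-vert
    with grow (λ _ → ⊤) _ (length vertices) v [] ≤-refl (singleton-path v-vert) tt
  ... | inj₂ cycle = inj₂ cycle
  ... | inj₁ (h , ps , I , _ , h-stuck) with turn-around I h-stuck
  ... | e , rest , I′ , h-end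
    with grow (EndsStuckAt h) ends-stuck-∷ (length vertices) e rest (s≤s (m≤n+m _ _)) I′ h-end
  ...   | inj₂ cycle = inj₂ cycle
  ...   | inj₁ (_ , _ , I″ , h-end′ , stuck) = inj₁ (both-ends-stuck⇒path I″ h-end′ stuck)

TwoApart : ℕ → ℕ → Set
TwoApart m n = n ≡ 2 + m ⊎ m ≡ 2 + n

-- A ±2 walk without repeated values cannot turn back, since turning back revisits a value.
ascending-stays-above : ∀ a c ℓ z → Unique (a ∷ 2 + a ∷ c ∷ ℓ) →
  Linked TwoApart ((2 + a ∷ c ∷ ℓ) ∷ʳ z) → a < z
ascending-stays-above a c ℓ z ((_ ∷ a≢c ∷ _) ∷ _) (inj₂ refl ∷ _) = ⊥-elim (a≢c refl)
ascending-stays-above a c [] z _ (inj₁ refl ∷ inj₁ refl ∷ [-]) = s≤s (m≤n+m a 5)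
ascending-stays-above a c [] z _ (inj₁ refl ∷ inj₂ refl ∷ [-]) = s≤s (m≤n+m a 1)
ascending-stays-above a c (d ∷ ℓ) z (_ ∷ u) (inj₁ refl ∷ l) =
  <-trans (s≤s (m≤n+m a 1)) (ascending-stays-above (2 + a) d ℓ z u l)

descending-stays-below : ∀ b c ℓ z → Unique (2 + b ∷ b ∷ c ∷ ℓ) →
  Linked TwoApart ((b ∷ c ∷ ℓ) ∷ʳ z) → z < 2 + b
descending-stays-below b c ℓ z ((_ ∷ b′≢c ∷ _) ∷ _) (inj₁ refl ∷ _) = ⊥-elim (b′≢c refl)
descending-stays-below b c [] z _ (inj₂ refl ∷ inj₂ refl ∷ [-]) = s≤s (m≤n+m z 5)
descending-stays-below b c [] z _ (inj₂ refl ∷ inj₁ refl ∷ [-]) = s≤s (m≤n+m z 1)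
descending-stays-below b c (d ∷ ℓ) z (_ ∷ u) (inj₂ refl ∷ l) =
  <-trans (descending-stays-below c d ℓ z u l) (s≤s (m≤n+m _ 1))

no-unique-closed-walk-two-apart : ∀ n₀ n₁ n₂ ns → Unique (n₀ ∷ n₁ ∷ n₂ ∷ ns) →
  ¬ Linked TwoApart ((n₀ ∷ n₁ ∷ n₂ ∷ ns) ∷ʳ n₀)
no-unique-closed-walk-two-apart n₀ n₁ n₂ ns u (inj₁ refl ∷ l) = <-irrefl refl (ascending-stays-above n₀ n₂ ns n₀ u l)
no-unique-closed-walk-two-apart n₀ n₁ n₂ ns u (inj₂ refl ∷ l) = <-irrefl refl (descending-stays-below n₁ n₂ ns n₀ u l)

CommonNeighbour : (G : Graph) → V G → V G → Set
CommonNeighbour G u w = u ≢ w × ∃ λ c → Adj G u c × Adj G c w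

module PathComponents {G : Graph} (S : IsFiniteSimpleGraph G) where

  open IsFiniteSimpleGraph S
  open Walks S

  private
    A = V G

  reach-along : ∀ {v x xs} → Reach G v x → Linked (CommonNeighbour G) (x ∷ xs) → All (Reach G v) (x ∷ xs)
  reach-along r [-] = r ∷ []
  reach-along r ((_ , _ , xc , cy) ∷ l) = r ∷ reach-along (reach-∷ʳ (reach-∷ʳ r xc) cy) l

  position : A → List A → ℕ
  position a [] = 0
  position a (x ∷ xs) with a ≟ᵥ x
  ... | yes _ = 0
  ... | no _ = suc (position a xs)

  position-injective : ∀ {a b L} → a ∈ L → b ∈ L → position a L ≡ position b L → a ≡ b
  position-injective {a} {b} {x ∷ xs} a∈ b∈ eq with a ≟ᵥ x | b ≟ᵥ x
  ... | yes a≡x | yes b≡x = trans a≡x (sym b≡x)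
  position-injective (here a≡x) _ _ | no a≢x | _ = ⊥-elim (a≢x a≡x)
  position-injective _ (here b≡x) _ | _ | no b≢x = ⊥-elim (b≢x b≡x)
  position-injective (there a∈) (there b∈) eq | no _ | no _ = position-injective a∈ b∈ (suc-injective eq)

  position-middle : ∀ xs {a ys} → a ∉ xs → position a (xs ++ a ∷ ys) ≡ length xs
  position-middle [] {a} _ with a ≟ᵥ a
  ... | yes _ = refl
  ... | no a≢a = ⊥-elim (a≢a refl)
  position-middle (x ∷ xs) {a} a∉ with a ≟ᵥ x
  ... | yes a≡x = ⊥-elim (a∉ (here a≡x))
  ... | no _ = cong suc (position-middle xs (a∉ ∘ there))

  position-step : ∀ xs {a b ys} → Unique (xs ++ a ∷ b ∷ ys) →
    position b (xs ++ a ∷ b ∷ ys) ≡ suc (position a (xs ++ a ∷ b ∷ ys))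
  position-step xs {a} {b} {ys} u = begin
    position b (xs ++ a ∷ b ∷ ys)       ≡⟨ cong (position b) (sym (∷ʳ-++ xs a (b ∷ ys))) ⟩
    position b ((xs ∷ʳ a) ++ b ∷ ys)    ≡⟨ position-middle (xs ∷ʳ a) (unique-middle-∉ (xs ∷ʳ a) u′) ⟩
    length (xs ∷ʳ a)                    ≡⟨ length-∷ʳ xs a ⟩
    suc (length xs)                     ≡⟨ cong suc (sym (position-middle xs (unique-middle-∉ xs u))) ⟩
    suc (position a (xs ++ a ∷ b ∷ ys)) ∎
    where
    open ≡-Reasoning
    u′ : Unique ((xs ∷ʳ a) ++ b ∷ ys)
    u′ = subst Unique (sym (∷ʳ-++ xs a (b ∷ ys))) u

  position-consecutive : ∀ {L a b} → Unique L → Consecutive L a b →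
    position b L ≡ suc (position a L) ⊎ position a L ≡ suc (position b L)
  position-consecutive u (xs , _ , inj₁ refl) = inj₁ (position-step xs u)
  position-consecutive u (xs , _ , inj₂ refl) = inj₂ (position-step xs u)

  no-common-neighbour-cycle-on-path : ∀ {v u₀ u₁ u₂ us} → ComponentIsPath G v → Reach G v u₀ →
    Unique (u₀ ∷ u₁ ∷ u₂ ∷ us) → ¬ Linked (CommonNeighbour G) ((u₀ ∷ u₁ ∷ u₂ ∷ us) ∷ʳ u₀)
  no-common-neighbour-cycle-on-path {v} {u₀} {u₁} {u₂} {us} (L , (L-unique , L-component) , L-path) r₀ u cycle =
    no-unique-closed-walk-two-apart _ _ _ _
      (unique-map-on (λ a∈ b∈ → position-injective a∈ b∈) (proj₁ (∷ʳ⁻ on-path)) u)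
      (subst (Linked TwoApart) (map-++ f (u₀ ∷ u₁ ∷ u₂ ∷ us) (u₀ ∷ []))
        (Linked.map⁺ (linked-map-on common-neighbour-two-apart on-path cycle)))
    where
    f : A → ℕ
    f a = position a L
    on-path : All (_∈ L) ((u₀ ∷ u₁ ∷ u₂ ∷ us) ∷ʳ u₀)
    on-path = All.map (Equivalence.from (L-component _)) (reach-along r₀ cycle)
    adjacent-positions : ∀ {a b} → a ∈ L → b ∈ L → Adj G a b → f b ≡ suc (f a) ⊎ f a ≡ suc (f b)
    adjacent-positions a∈ b∈ ab = position-consecutive L-unique (Equivalence.to (L-path _ _ a∈ b∈) ab)
    common-neighbour-two-apart : ∀ {a b} → a ∈ L → b ∈ L → CommonNeighbour G a b → TwoApart (f a) (f b)
    common-neighbour-two-apart {a} {b} a∈ b∈ (a≢b , c , ac , cb)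
      with c∈ ← Equivalence.from (L-component c) (reach-∷ʳ (Equivalence.to (L-component a) a∈) ac)
      with adjacent-positions a∈ c∈ ac | adjacent-positions c∈ b∈ cb
    ... | inj₁ c-after-a | inj₁ b-after-c = inj₁ (trans b-after-c (cong suc c-after-a))
    ... | inj₂ c-before-a | inj₂ b-before-c = inj₂ (trans c-before-a (cong suc b-before-c))
    ... | inj₁ c-after-a | inj₂ b-before-c = ⊥-elim (a≢b (position-injective a∈ b∈ (suc-injective (trans (sym c-after-a) b-before-c))))
    ... | inj₂ c-before-a | inj₁ b-after-c = ⊥-elim (a≢b (position-injective a∈ b∈ (trans c-before-a (sym b-after-c))))

module _ {A : Set} {R : Rel A 0ℓ} where

  square-rotate : ∀ {a b c d} → Linked R (a ∷ b ∷ c ∷ d ∷ a ∷ []) → Linked R (b ∷ c ∷ d ∷ a ∷ b ∷ [])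
  square-rotate (ab ∷ bc ∷ cd ∷ da ∷ [-]) = bc ∷ cd ∷ da ∷ ab ∷ [-]

  ∈-rotate : ∀ {x a b c d : A} → x ∈ a ∷ b ∷ c ∷ d ∷ [] → x ∈ b ∷ c ∷ d ∷ a ∷ []
  ∈-rotate (here refl) = there (there (there (here refl)))
  ∈-rotate (there x∈) = ∈-++⁺ˡ x∈

  square-opposite : Symmetric R → ∀ {a b c d y} → Linked R (a ∷ b ∷ c ∷ d ∷ a ∷ []) →
    y ∈ a ∷ b ∷ c ∷ d ∷ [] → a ≢ y → ¬ R a y → y ≡ c
  square-opposite R-sym _ (here refl) a≢a _ = ⊥-elim (a≢a refl)
  square-opposite R-sym (ab ∷ _) (there (here refl)) _ ¬ab = ⊥-elim (¬ab ab)
  square-opposite R-sym _ (there (there (here refl))) _ _ = refl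
  square-opposite R-sym (_ ∷ _ ∷ _ ∷ da ∷ [-]) (there (there (there (here refl)))) _ ¬ad = ⊥-elim (¬ad (R-sym da))

  square-non-neighbours-equal : Symmetric R → ∀ {a b c d x y z} → Linked R (a ∷ b ∷ c ∷ d ∷ a ∷ []) →
    x ∈ a ∷ b ∷ c ∷ d ∷ [] → y ∈ a ∷ b ∷ c ∷ d ∷ [] → z ∈ a ∷ b ∷ c ∷ d ∷ [] →
    x ≢ y → x ≢ z → ¬ R x y → ¬ R x z → y ≡ z
  square-non-neighbours-equal R-sym sq (here refl) y∈ z∈ x≢y x≢z ¬xy ¬xz =
    trans (square-opposite R-sym sq y∈ x≢y ¬xy) (sym (square-opposite R-sym sq z∈ x≢z ¬xz))
  square-non-neighbours-equal R-sym sq (there (here refl)) y∈ z∈ =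
    square-non-neighbours-equal R-sym (square-rotate sq) (here refl) (∈-rotate y∈) (∈-rotate z∈)
  square-non-neighbours-equal R-sym sq (there (there (here refl))) y∈ z∈ =
    square-non-neighbours-equal R-sym (square-rotate (square-rotate sq)) (here refl)
      (∈-rotate (∈-rotate y∈)) (∈-rotate (∈-rotate z∈))
  square-non-neighbours-equal R-sym sq (there (there (there (here refl)))) y∈ z∈ =
    square-non-neighbours-equal R-sym (square-rotate (square-rotate (square-rotate sq))) (here refl)
      (∈-rotate (∈-rotate (∈-rotate y∈))) (∈-rotate (∈-rotate (∈-rotate z∈)))

  square-induced : (∀ {a} → ¬ R a a) → (∀ {a b c} → R a b → R b c → ¬ R c a) →
    ∀ {a b c d x y} → Linked R (a ∷ b ∷ c ∷ d ∷ a ∷ []) →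
    x ∈ a ∷ b ∷ c ∷ d ∷ [] → y ∈ a ∷ b ∷ c ∷ d ∷ [] → R x y → Consecutive (a ∷ b ∷ c ∷ d ∷ a ∷ []) x y
  square-induced irr tri {a} {b} {c} {d} (ab ∷ bc ∷ cd ∷ da ∷ [-]) = adjacent⇒consecutive
    where
    Q = a ∷ b ∷ c ∷ d ∷ []
    adjacent⇒consecutive : ∀ {x y} → x ∈ Q → y ∈ Q → R x y → Consecutive (a ∷ b ∷ c ∷ d ∷ a ∷ []) x y
    adjacent⇒consecutive (here refl)                         (here refl)                         xy = ⊥-elim (irr xy)
    adjacent⇒consecutive (here refl)                         (there (here refl))                 _  = [] , c ∷ d ∷ a ∷ [] , inj₁ refl
    adjacent⇒consecutive (here refl)                         (there (there (here refl)))         xy = ⊥-elim (tri xy cd da)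
    adjacent⇒consecutive (here refl)                         (there (there (there (here refl)))) _  = a ∷ b ∷ c ∷ [] , [] , inj₂ refl
    adjacent⇒consecutive (there (here refl))                 (here refl)                         _  = [] , c ∷ d ∷ a ∷ [] , inj₂ refl
    adjacent⇒consecutive (there (here refl))                 (there (here refl))                 xy = ⊥-elim (irr xy)
    adjacent⇒consecutive (there (here refl))                 (there (there (here refl)))         _  = a ∷ [] , d ∷ a ∷ [] , inj₁ refl
    adjacent⇒consecutive (there (here refl))                 (there (there (there (here refl)))) xy = ⊥-elim (tri xy da ab)
    adjacent⇒consecutive (there (there (here refl)))         (here refl)                         xy = ⊥-elim (tri ab bc xy)
    adjacent⇒consecutive (there (there (here refl)))         (there (here refl))                 _  = a ∷ [] , d ∷ a ∷ [] , inj₂ refl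
    adjacent⇒consecutive (there (there (here refl)))         (there (there (here refl)))         xy = ⊥-elim (irr xy)
    adjacent⇒consecutive (there (there (here refl)))         (there (there (there (here refl)))) _  = a ∷ b ∷ [] , a ∷ [] , inj₁ refl
    adjacent⇒consecutive (there (there (there (here refl)))) (here refl)                         _  = a ∷ b ∷ c ∷ [] , [] , inj₁ refl
    adjacent⇒consecutive (there (there (there (here refl)))) (there (here refl))                 xy = ⊥-elim (tri bc cd xy)
    adjacent⇒consecutive (there (there (there (here refl)))) (there (there (here refl)))         _  = a ∷ b ∷ [] , a ∷ [] , inj₂ refl
    adjacent⇒consecutive (there (there (there (here refl)))) (there (there (there (here refl)))) xy = ⊥-elim (irr xy)

prime>1 : ∀ {p} → Prime p → 1 < p
prime>1 {p} p-prime = nonTrivial⇒n>1 p {{prime⇒nonTrivial p-prime}}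

prime∣⇒≢1 : ∀ {p x} → Prime p → p ∣ x → x ≢ 1
prime∣⇒≢1 p-prime p∣1 refl = <-irrefl (sym (∣1⇒≡1 p∣1)) (prime>1 p-prime)

distinct-primes-*-∣ : ∀ {p q x} → Prime p → Prime q → p ≢ q → p ∣ x → q ∣ x → p * q ∣ x
distinct-primes-*-∣ {p} {q} p-prime q-prime p≢q p∣x q∣x
  with euclidsLemma (quotient q∣x) q p-prime (subst (p ∣_) (m∣n⇒n≡quotient*m q∣x) p∣x)
... | inj₁ p∣k = subst (p * q ∣_) (sym (m∣n⇒n≡quotient*m q∣x)) (*-monoˡ-∣ q p∣k)
... | inj₂ p∣q with prime⇒irreducible q-prime p∣q
...   | inj₁ p≡1 = ⊥-elim (<-irrefl (sym p≡1) (prime>1 p-prime))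
...   | inj₂ p≡q = ⊥-elim (p≢q p≡q)

common-prime⇒1<gcd : ∀ {p x y} → Prime p → p ∣ x → p ∣ y → 0 < x → 1 < gcd x y
common-prime⇒1<gcd {p} {x} {y} p-prime p∣x p∣y 0<x =
  <-≤-trans (prime>1 p-prime) (∣⇒≤ {{gcd≢0}} (gcd-greatest p∣x p∣y))
  where
  gcd≢0 = ≢-nonZero (gcd[m,n]≢0 x y (inj₁ (λ { refl → <-irrefl refl 0<x })))

prime-divisor : ∀ {n} → 1 < n → ∃ λ p → Prime p × p ∣ n
prime-divisor {suc n} 1<n with factorise (suc n)
... | record { factors = p ∷ ps ; isFactorisation = eq ; factorsPrime = p-prime ∷ _ } =
  p , p-prime , subst (p ∣_) (sym eq) (m∣m*n (product ps))
prime-divisor {suc zero} (s≤s ()) | record { factors = [] }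

triangle⇒cycle : (G : Graph) → ∀ {a b c} → a ≢ b → a ≢ c → b ≢ c → Vert G a → Vert G b → Vert G c →
  Adj G a b → Adj G b c → Adj G c a → HasCycle G
triangle⇒cycle G a≢b a≢c b≢c va vb vc ab bc ca =
  _ , _ ∷ _ ∷ [] , s≤s (s≤s z≤n) , (a≢b ∷ a≢c ∷ []) ∷ (b≢c ∷ []) ∷ [] ∷ [] , va ∷ vb ∷ vc ∷ [] , ab ∷ bc ∷ ca ∷ [-]

module GraphsOf (X : List ℕ) (X-positive : ∀ x → x ∈ X → 0 < x) where

  open import Data.List.Membership.DecPropositional _≟_ using (_∈?_)

  private
    B = Bip X

  divides? : ∀ p x → Dec (InRho X p × InXStar X x × p ∣ x)
  divides? p x with prime? p | x ∈? X | x ≟ 1 | p ∣? x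
  ... | no ¬prime | _ | _ | _ = no λ ((p-prime , _) , _) → ¬prime p-prime
  ... | yes _ | no x∉X | _ | _ = no λ (_ , (x∈X , _) , _) → x∉X x∈X
  ... | yes _ | yes _ | yes x≡1 | _ = no λ (_ , (_ , x≢1) , _) → x≢1 x≡1
  ... | yes _ | yes _ | no _ | no p∤x = no λ (_ , _ , p∣x) → p∤x p∣x
  ... | yes p-prime | yes x∈X | no x≢1 | yes p∣x = yes ((p-prime , x , x∈X , p∣x) , (x∈X , x≢1) , p∣x)

  bip-adj? : Decidable (BAdj X)
  bip-adj? (inj₁ _) (inj₁ _) = no λ ()
  bip-adj? (inj₂ _) (inj₂ _) = no λ ()
  bip-adj? (inj₁ p) (inj₂ x) = divides? p x
  bip-adj? (inj₂ x) (inj₁ p) = divides? p x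

  bip-adj-sym : Symmetric (BAdj X)
  bip-adj-sym {inj₁ _} {inj₂ _} pq = pq
  bip-adj-sym {inj₂ _} {inj₁ _} pq = pq

  bip-adj-vert : ∀ {a b} → BAdj X a b → BVert X b
  bip-adj-vert {inj₁ _} {inj₂ _} (_ , x* , _) = x*
  bip-adj-vert {inj₂ _} {inj₁ _} (ρp , _ , _) = ρp

  bip-no-triangle : ∀ {a b c} → BAdj X a b → BAdj X b c → ¬ BAdj X c a
  bip-no-triangle {inj₁ _} {inj₁ _} ()
  bip-no-triangle {inj₂ _} {inj₂ _} ()
  bip-no-triangle {inj₁ _} {inj₂ _} {inj₁ _} _ _ ()
  bip-no-triangle {inj₁ _} {inj₂ _} {inj₂ _} _ ()
  bip-no-triangle {inj₂ _} {inj₁ _} {inj₁ _} _ ()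
  bip-no-triangle {inj₂ _} {inj₁ _} {inj₂ _} _ _ ()

  -- A prime of ρ(X) divides a positive element, so it is at most that element.
  prime-candidates : ℕ → List (ℕ ⊎ ℕ)
  prime-candidates x = map inj₁ (upTo (suc x))

  bip-vertices : List (ℕ ⊎ ℕ)
  bip-vertices = concatMap prime-candidates X ++ map inj₂ X

  bip-vertices-complete : ∀ {a} → BVert X a → a ∈ bip-vertices
  bip-vertices-complete {inj₁ p} (_ , x , x∈X , p∣x) =
    ∈-++⁺ˡ (∈-concatMap⁺ prime-candidates (lose x∈X (∈-map⁺ inj₁ (∈-upTo⁺ (s≤s (∣⇒≤ {{>-nonZero (X-positive x x∈X)}} p∣x))))))
  bip-vertices-complete {inj₂ x} (x∈X , _) = ∈-++⁺ʳ _ (∈-map⁺ inj₂ x∈X)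

  bip : IsFiniteSimpleGraph B
  bip = record
    { _≟ᵥ_ = ≡-dec _≟_ _≟_
    ; adj? = bip-adj?
    ; adj-sym = bip-adj-sym
    ; adj-irrefl = λ { {inj₁ _} () ; {inj₂ _} () }
    ; adj-vert = bip-adj-vert
    ; vertices = bip-vertices
    ; vertices-complete = bip-vertices-complete
    }

  shared-prime⇒Γ-adj : ∀ {p x y} → InRho X p → InXStar X x → InXStar X y → x ≢ y → p ∣ x → p ∣ y →
    Adj (Gamma X) x y
  shared-prime⇒Γ-adj (p-prime , _) x*@(x∈X , _) y* x≢y p∣x p∣y =
    x* , y* , x≢y , common-prime⇒1<gcd p-prime p∣x p∣y (X-positive _ x∈X)

  shared-element⇒Δ-adj : ∀ {p q x} → InRho X p → InRho X q → p ≢ q → x ∈ X → p ∣ x → q ∣ x →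
    Adj (Delta X) p q
  shared-element⇒Δ-adj ρp@(p-prime , _) ρq@(q-prime , _) p≢q x∈X p∣x q∣x =
    ρp , ρq , p≢q , _ , x∈X , distinct-primes-*-∣ p-prime q-prime p≢q p∣x q∣x

  rights : List (ℕ ⊎ ℕ) → List ℕ
  rights [] = []
  rights (inj₁ _ ∷ ℓ) = rights ℓ
  rights (inj₂ x ∷ ℓ) = x ∷ rights ℓ

  ∈-rights : ∀ {x ℓ} → x ∈ rights ℓ → inj₂ x ∈ ℓ
  ∈-rights {ℓ = inj₁ _ ∷ ℓ} x∈ = there (∈-rights x∈)
  ∈-rights {ℓ = inj₂ _ ∷ ℓ} (here refl) = here refl
  ∈-rights {ℓ = inj₂ _ ∷ ℓ} (there x∈) = there (∈-rights x∈)

  unique-rights : ∀ {ℓ} → Unique ℓ → Unique (rights ℓ)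
  unique-rights {[]} [] = []
  unique-rights {inj₁ _ ∷ ℓ} (_ ∷ u) = unique-rights u
  unique-rights {inj₂ _ ∷ ℓ} (x∉ ∷ u) = unique-∷ (λ x∈ → All.lookup x∉ (∈-rights x∈) refl) (unique-rights u)

  SharePrime : ℕ → ℕ → Set
  SharePrime x y = InXStar X x × InXStar X y × 1 < gcd x y

  linked-rights : ∀ x ℓ z → Linked (BAdj X) ((inj₂ x ∷ ℓ) ∷ʳ inj₂ z) → Linked SharePrime ((x ∷ rights ℓ) ∷ʳ z)
  linked-rights x [] z (() ∷ _)
  linked-rights x (inj₂ _ ∷ ℓ) z (() ∷ _)
  linked-rights x (inj₁ _ ∷ inj₁ _ ∷ ℓ) z (_ ∷ () ∷ _)
  linked-rights x (inj₁ p ∷ []) z ((ρp , x* , p∣x) ∷ (_ , z* , p∣z) ∷ [-]) =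
    (x* , z* , common-prime⇒1<gcd (proj₁ ρp) p∣x p∣z (X-positive x (proj₁ x*))) ∷ [-]
  linked-rights x (inj₁ p ∷ inj₂ y ∷ ℓ) z ((ρp , x* , p∣x) ∷ (_ , y* , p∣y) ∷ l) =
    (x* , y* , common-prime⇒1<gcd (proj₁ ρp) p∣x p∣y (X-positive x (proj₁ x*))) ∷ linked-rights y ℓ z l

  module _ (Γ-acyclic : Acyclic (Gamma X)) (Δ-acyclic : Acyclic (Delta X)) where

    bip-degree≤2 : ∀ {a b c d} → BAdj X a b → BAdj X a c → BAdj X a d → b ≢ c → b ≢ d → c ≢ d → ⊥
    bip-degree≤2 {inj₁ _} {inj₁ _} ()
    bip-degree≤2 {inj₁ _} {inj₂ _} {inj₁ _} _ ()
    bip-degree≤2 {inj₁ _} {inj₂ _} {inj₂ _} {inj₁ _} _ _ ()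
    bip-degree≤2 {inj₂ _} {inj₂ _} ()
    bip-degree≤2 {inj₂ _} {inj₁ _} {inj₂ _} _ ()
    bip-degree≤2 {inj₂ _} {inj₁ _} {inj₁ _} {inj₂ _} _ _ ()
    bip-degree≤2 {inj₁ p} {inj₂ x} {inj₂ y} {inj₂ z} (ρp , x* , p∣x) (_ , y* , p∣y) (_ , z* , p∣z) x≢y x≢z y≢z =
      Γ-acyclic (triangle⇒cycle (Gamma X) (x≢y ∘ cong inj₂) (x≢z ∘ cong inj₂) (y≢z ∘ cong inj₂) x* y* z*
        (shared-prime⇒Γ-adj ρp x* y* (x≢y ∘ cong inj₂) p∣x p∣y)
        (shared-prime⇒Γ-adj ρp y* z* (y≢z ∘ cong inj₂) p∣y p∣z)
        (shared-prime⇒Γ-adj ρp z* x* (x≢z ∘ sym ∘ cong inj₂) p∣z p∣x))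
    bip-degree≤2 {inj₂ x} {inj₁ p} {inj₁ q} {inj₁ r} (ρp , (x∈X , _) , p∣x) (ρq , _ , q∣x) (ρr , _ , r∣x) p≢q p≢r q≢r =
      Δ-acyclic (triangle⇒cycle (Delta X) (p≢q ∘ cong inj₁) (p≢r ∘ cong inj₁) (q≢r ∘ cong inj₁) ρp ρq ρr
        (shared-element⇒Δ-adj ρp ρq (p≢q ∘ cong inj₁) x∈X p∣x q∣x)
        (shared-element⇒Δ-adj ρq ρr (q≢r ∘ cong inj₁) x∈X q∣x r∣x)
        (shared-element⇒Δ-adj ρr ρp (p≢r ∘ sym ∘ cong inj₁) x∈X r∣x p∣x))

    -- Every other vertex of the cycle is an element of X, and consecutive ones share the prime between them.
    element-cycle⇒Γ-cycle : ∀ x vs → 4 ≤ length vs → Unique (inj₂ x ∷ vs) →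
      Linked (BAdj X) ((inj₂ x ∷ vs) ∷ʳ inj₂ x) → HasCycle (Gamma X)
    element-cycle⇒Γ-cycle x [] ()
    element-cycle⇒Γ-cycle x (_ ∷ []) (s≤s ())
    element-cycle⇒Γ-cycle x (_ ∷ _ ∷ []) (s≤s (s≤s ()))
    element-cycle⇒Γ-cycle x (_ ∷ _ ∷ _ ∷ []) (s≤s (s≤s (s≤s ())))
    element-cycle⇒Γ-cycle x (inj₂ _ ∷ _) _ _ (() ∷ _)
    element-cycle⇒Γ-cycle x (inj₁ _ ∷ inj₁ _ ∷ _) _ _ (_ ∷ () ∷ _)
    element-cycle⇒Γ-cycle x (inj₁ _ ∷ inj₂ _ ∷ inj₂ _ ∷ _) _ _ (_ ∷ _ ∷ () ∷ _)
    element-cycle⇒Γ-cycle x (inj₁ _ ∷ inj₂ _ ∷ inj₁ _ ∷ inj₁ _ ∷ _) _ _ (_ ∷ _ ∷ _ ∷ () ∷ _)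
    element-cycle⇒Γ-cycle x vs@(inj₁ _ ∷ inj₂ y ∷ inj₁ _ ∷ inj₂ z ∷ rest) _ u cycle =
      x , y ∷ z ∷ rights rest , s≤s (s≤s z≤n) , u′ , linked-sources proj₁ _ Γ-cycle , Γ-cycle
      where
      u′ : Unique (x ∷ y ∷ z ∷ rights rest)
      u′ = unique-rights u
      Γ-cycle : Linked (Adj (Gamma X)) ((x ∷ y ∷ z ∷ rights rest) ∷ʳ x)
      Γ-cycle = Linked.zipWith (λ ((x* , y* , 1<gcd) , x≢y) → x* , y* , x≢y , 1<gcd)
        (linked-rights x vs x cycle , closed-walk-steps-distinct _ u′)

    long-cycle⇒Γ-cycle : ∀ w vs → 4 ≤ length vs → Unique (w ∷ vs) →
      Linked (BAdj X) ((w ∷ vs) ∷ʳ w) → HasCycle (Gamma X)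
    long-cycle⇒Γ-cycle (inj₂ x) vs = element-cycle⇒Γ-cycle x vs
    long-cycle⇒Γ-cycle (inj₁ _) (inj₁ _ ∷ _) _ _ (() ∷ _)
    long-cycle⇒Γ-cycle w@(inj₁ _) (inj₂ x ∷ vs) (s≤s 3≤len) u cycle =
      element-cycle⇒Γ-cycle x (vs ∷ʳ w) (subst (4 ≤_) (sym (length-∷ʳ vs w)) (s≤s 3≤len))
        (unique-rotate u) (closed-walk-rotate vs cycle)

    hamiltonian-cycle⇒square : ∀ {v} → ComponentHasHamiltonianCycle B v → ComponentIsC4 B v
    hamiltonian-cycle⇒square (_ , [] , () , _)
    hamiltonian-cycle⇒square (_ , _ ∷ [] , s≤s () , _)
    hamiltonian-cycle⇒square (w , e ∷ q ∷ [] , _ , _ , wb ∷ bc ∷ cw ∷ [-]) = ⊥-elim (bip-no-triangle wb bc cw)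
    hamiltonian-cycle⇒square (w , e ∷ q ∷ r ∷ [] , _ , component , square) =
      w , e , q , r , component ,
      λ _ _ x∈ y∈ → mk⇔ (square-induced (λ { {inj₁ _} () ; {inj₂ _} () }) bip-no-triangle square x∈ y∈)
                        (linked-consecutive bip-adj-sym square)
    hamiltonian-cycle⇒square (w , vs@(_ ∷ _ ∷ _ ∷ _ ∷ _) , _ , (u , _) , cycle) =
      ⊥-elim (Γ-acyclic (long-cycle⇒Γ-cycle w vs (s≤s (s≤s (s≤s (s≤s z≤n)))) u cycle))

  Γ-adj⇒common-prime : ∀ {x y} → Adj (Gamma X) x y → CommonNeighbour B (inj₂ x) (inj₂ y)
  Γ-adj⇒common-prime {x} {y} (x* , y* , x≢y , 1<gcd) with prime-divisor 1<gcd
  ... | p , p-prime , p∣gcd = x≢y ∘ inj₂-injective , inj₁ p , (ρp , x* , p∣x) , (ρp , y* , p∣y)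
    where
    p∣x = ∣-trans p∣gcd (gcd[m,n]∣m x y)
    p∣y = ∣-trans p∣gcd (gcd[m,n]∣n x y)
    ρp : InRho X p
    ρp = p-prime , x , proj₁ x* , p∣x

  Δ-adj⇒common-element : ∀ {p q} → Adj (Delta X) p q → CommonNeighbour B (inj₁ p) (inj₁ q)
  Δ-adj⇒common-element {p} {q} (ρp , ρq , p≢q , x , x∈X , pq∣x) =
    p≢q ∘ inj₁-injective , inj₂ x , (ρp , x* , p∣x) , (ρq , x* , q∣x)
    where
    p∣x = m*n∣⇒m∣ p q pq∣x
    q∣x = m*n∣⇒n∣ p q pq∣x
    x* : InXStar X x
    x* = x∈X , prime∣⇒≢1 (proj₁ ρp) p∣x

  module _ (components : ∀ v → BVert X v → ComponentIsPath B v ⊎ ComponentIsC4 B v) where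

    open PathComponents bip

    no-independent-common-neighbour-cycle : ∀ {u₀ u₁ u₂ us} → BVert X u₀ → Unique (u₀ ∷ u₁ ∷ u₂ ∷ us) →
      Linked (CommonNeighbour B) ((u₀ ∷ u₁ ∷ u₂ ∷ us) ∷ʳ u₀) → ¬ BAdj X u₀ u₁ → ¬ BAdj X u₀ u₂ → ⊥
    no-independent-common-neighbour-cycle {u₀} u₀-vert u cycle ¬u₀u₁ ¬u₀u₂ with components u₀ u₀-vert
    ... | inj₁ path = no-common-neighbour-cycle-on-path path (here u₀-vert) u cycle
    ... | inj₂ (a , b , c , d , (_ , component) , square-adj)
      with r₀ ∷ r₁ ∷ r₂ ∷ _ ← reach-along (here u₀-vert) cycle
      with (u₀≢u₁ ∷ u₀≢u₂ ∷ _) ∷ (u₁≢u₂ ∷ _) ∷ _ ← u =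
      u₁≢u₂ (square-non-neighbours-equal bip-adj-sym square (in-square r₀) (in-square r₁) (in-square r₂)
        u₀≢u₁ u₀≢u₂ ¬u₀u₁ ¬u₀u₂)
      where
      in-square : ∀ {x} → Reach B u₀ x → x ∈ a ∷ b ∷ c ∷ d ∷ []
      in-square = Equivalence.from (component _)
      square : Linked (BAdj X) (a ∷ b ∷ c ∷ d ∷ a ∷ [])
      square =
        Equivalence.from (square-adj _ _ (here refl) (there (here refl))) ([] , c ∷ d ∷ a ∷ [] , inj₁ refl) ∷
        Equivalence.from (square-adj _ _ (there (here refl)) (there (there (here refl)))) (a ∷ [] , d ∷ a ∷ [] , inj₁ refl) ∷
        Equivalence.from (square-adj _ _ (there (there (here refl))) (there (there (there (here refl))))) (a ∷ b ∷ [] , a ∷ [] , inj₁ refl) ∷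
        Equivalence.from (square-adj _ _ (there (there (there (here refl)))) (here refl)) (a ∷ b ∷ c ∷ [] , [] , inj₁ refl) ∷ [-]

    one-sided-acyclic : (G : Graph) (side : V G → ℕ ⊎ ℕ) → (∀ {x y} → side x ≡ side y → x ≡ y) →
      (∀ {x y} → ¬ BAdj X (side x) (side y)) → (∀ {x} → Vert G x → BVert X (side x)) →
      (∀ {x y} → Adj G x y → CommonNeighbour B (side x) (side y)) → Acyclic G
    one-sided-acyclic G _ _ _ _ _ (_ , [] , () , _)
    one-sided-acyclic G _ _ _ _ _ (_ , _ ∷ [] , s≤s () , _)
    one-sided-acyclic G side side-injective same-side side-vert adj⇒common (x₀ , x₁ ∷ x₂ ∷ xs , _ , u , x₀-vert ∷ _ , cycle) =
      no-independent-common-neighbour-cycle (side-vert x₀-vert) (Unique.map⁺ side-injective u)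
        (subst (Linked (CommonNeighbour B)) (map-++ side (x₀ ∷ x₁ ∷ x₂ ∷ xs) (x₀ ∷ []))
          (Linked.map⁺ (Linked.map adj⇒common cycle)))
        same-side same-side

    Γ-acyclic : Acyclic (Gamma X)
    Γ-acyclic = one-sided-acyclic (Gamma X) inj₂ inj₂-injective (λ ()) (λ x* → x*) Γ-adj⇒common-prime

    Δ-acyclic : Acyclic (Delta X)
    Δ-acyclic = one-sided-acyclic (Delta X) inj₁ inj₁-injective (λ ()) (λ ρp → ρp) Δ-adj⇒common-element

-- The hypotheses X ≢ [] and X ⊈ {1} are unused: for X ⊆ {1} all three graphs are empty.
theorem4p2 : (X : List ℕ) → X ≢ [] → (∀ x → x ∈ X → 0 < x) →
    ¬ (∀ x → x ∈ X → x ≡ 1) →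
    ((Acyclic (Gamma X) × Acyclic (Delta X)) ⇔
     (∀ v → BVert X v → ComponentIsPath (Bip X) v ⊎ ComponentIsC4 (Bip X) v))
theorem4p2 X _ X-positive _ = mk⇔ paths-and-squares (λ components → Γ-acyclic components , Δ-acyclic components)
  where
  open GraphsOf X X-positive
  paths-and-squares : Acyclic (Gamma X) × Acyclic (Delta X) →
    ∀ v → BVert X v → ComponentIsPath (Bip X) v ⊎ ComponentIsC4 (Bip X) v
  paths-and-squares (Γ-acyclic , Δ-acyclic) v v-vert =
    Sum.map₂ (hamiltonian-cycle⇒square Γ-acyclic Δ-acyclic)
      (MaxDegreeTwo.component-path-or-cycle bip (bip-degree≤2 Γ-acyclic Δ-acyclic) v v-vert)
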